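{- Let $\mathcal{A}$ be a hereditary set of games (closed under taking options), and let $G,H$ be augmented forms such that: (i) for every $G^R$, either there is some $H^R$ with $G^R\geq_{\mathcal{A}}H^R$, or there is some $G^{RL}$ with $G^{RL}\geq_{\mathcal{A}}H$; (ii) for every $H^L$, either there is some $G^L$ with $G^L\geq_{\mathcal{A}}H^L$, or there is some $H^{LR}$ with $G\geq_{\mathcal{A}}H^{LR}$; (iii) if $G$ is Right end-like, then $H$ is Right $\mathcal{A}$-strong; and (iv) if $H$ is Left end-like, then $G$ is Left $\mathcal{A}$-strong. Then $G\geq_{\mathcal{A}}H$.
   Context: Games are short partizan game forms under the misère convention (a player unable to move wins); $o_L(G)$ (resp. $o_R(G)$) $\in\{\mathscr{L},\mathscr{R}\}$ is the winner when Left (resp. Right) moves first; outcome classes ordered $\mathscr{L}>\mathscr{N}>\mathscr{R}$, $\mathscr{L}>\mathscr{P}>\mathscr{R}$. Augmented forms (Siegel): game forms in which each subposition may carry a Left and/or Right tombstone (formal markers, not options; $G^L$, $G^R$ denote ordinary options only). An augmented form is Left end-like if it has no Left options or carries a Left tombstone (Right end-like symmetrically); a player to move on a position that is end-like for them wins immediately; $G+H$ carries a Left tombstone iff both are Left end-like and at least one carries a Left tombstone (symmetrically for Right). For a set of games $\mathcal{A}$, $G\geq_{\mathcal{A}}H$ means $o(G+X)\geq o(H+X)$ for all $X\in\mathcal{A}$. $G$ is Left $\mathcal{A}$-strong if $o_L(G+X)=\mathscr{L}$ for every Left end $X\in\mathcal{A}$; Right $\mathcal{A}$-strong if $o_R(G+X)=\mathscr{R}$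 for every Right end $X\in\mathcal{A}$. -}

module Defs where

open import Data.Nat using (ℕ; zero; suc; _+_)
open import Data.Fin using (Fin; zero; suc; splitAt)
open import Data.Bool using (Bool; true; false; _∧_; _∨_; if_then_else_)
open import Data.Sum using (_⊎_; inj₁; inj₂; [_,_]′)
open import Data.Product using (_×_; Σ; ∃-syntax)
open import Relation.Binary.PropositionalEquality using (_≡_)

-- Short augmented forms: finitely many Left/Right options (indexed by Fin)
-- plus a Left tombstone flag and a Right tombstone flag.
data Aug : Set where
  mk : (nl nr : ℕ) → (Fin nl → Aug) → (Fin nr → Aug) → (tL tR : Bool) → Aug

nL nR : Aug → ℕ
nL (mk a _ _ _ _ _) = a
nR (mk _ b _ _ _ _) = b

lOpt : (G : Aug) → Fin (nL G) → Aug
lOpt (mk _ _ l _ _ _) = l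

rOpt : (G : Aug) → Fin (nR G) → Aug
rOpt (mk _ _ _ r _ _) = r

tombL tombR : Aug → Bool
tombL (mk _ _ _ _ t _) = t
tombR (mk _ _ _ _ _ t) = t

isZero : ℕ → Bool
isZero zero = true
isZero (suc _) = false

leftEndLikeB rightEndLikeB : Aug → Bool
leftEndLikeB G = isZero (nL G) ∨ tombL G
rightEndLikeB G = isZero (nR G) ∨ tombR G

LeftEndLike RightEndLike : Aug → Set
LeftEndLike G = nL G ≡ 0 ⊎ tombL G ≡ true
RightEndLike G = nR G ≡ 0 ⊎ tombR G ≡ true

LeftEnd RightEnd : Aug → Set
LeftEnd X = nL X ≡ 0
RightEnd X = nR X ≡ 0

data IsGame : Aug → Set where
  isGame : ∀ {nl nr l r} → (∀ i → IsGame (l i)) → (∀ j → IsGame (r j)) →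
           IsGame (mk nl nr l r false false)

infixl 6 _⊕_
_⊕_ : Aug → Aug → Aug
mk a b gl gr tL tR ⊕ mk c d xl xr sL sR =
  mk (a + c) (b + d)
     (λ i → [ (λ k → gl k ⊕ mk c d xl xr sL sR)
            , (λ k → mk a b gl gr tL tR ⊕ xl k) ]′ (splitAt a i))
     (λ i → [ (λ k → gr k ⊕ mk c d xl xr sL sR)
            , (λ k → mk a b gl gr tL tR ⊕ xr k) ]′ (splitAt b i))
     (leftEndLikeB (mk a b gl gr tL tR) ∧ leftEndLikeB (mk c d xl xr sL sR) ∧ (tL ∨ sL))
     (rightEndLikeB (mk a b gl gr tL tR) ∧ rightEndLikeB (mk c d xl xr sL sR) ∧ (tR ∨ sR))

data Player : Set where
  Left Right : Player

isLeft isRight : Player → Bool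
isLeft Left = true
isLeft Right = false
isRight Left = false
isRight Right = true

anyFin : (n : ℕ) → (Fin n → Bool) → Bool
anyFin zero f = false
anyFin (suc n) f = f zero ∨ anyFin n (λ i → f (suc i))

-- Misère play on augmented forms: a player to move on a position that is
-- end-like for them wins immediately; otherwise they win iff they have an
-- option that they win with the opponent moving first.
-- oL G = winner when Left moves first, oR G = winner when Right moves first.
oL oR : Aug → Player
oL (mk a b gl gr tL tR) =
  if leftEndLikeB (mk a b gl gr tL tR) then Left
  else (if anyFin a (λ i → isLeft (oR (gl i))) then Left else Right)
oR (mk a b gl gr tL tR) =
  if rightEndLikeB (mk a b gl gr tL tR) then Right
  else (if anyFin b (λ j → isRight (oL (gr j))) then Right else Left)

data _≥P_ : Player → Player → Set where
  L≥ : ∀ {p} → Left ≥P p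
  R≥R : Right ≥P Right

-- Order on outcome classes (L > N > R, L > P > R) is the componentwise order
-- on the pair (oL, oR).
_≥o_ : Aug → Aug → Set
G ≥o H = (oL G ≥P oL H) × (oR G ≥P oR H)

Hereditary : (Aug → Set) → Set
Hereditary 𝒜 = ∀ X → 𝒜 X → (∀ i → 𝒜 (lOpt X i)) × (∀ j → 𝒜 (rOpt X j))

_≥[_]_ : Aug → (Aug → Set) → Aug → Set
G ≥[ 𝒜 ] H = ∀ X → 𝒜 X → (G ⊕ X) ≥o (H ⊕ X)

LeftStrong RightStrong : (Aug → Set) → Aug → Set
LeftStrong 𝒜 G = ∀ X → 𝒜 X → LeftEnd X → oL (G ⊕ X) ≡ Left
RightStrong 𝒜 G = ∀ X → 𝒜 X → RightEnd X → oR (G ⊕ X) ≡ Right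

{-# OPTIONS --safe #-}
-- Induction on the distinguishing game X, proving both inequalities
-- oL (G ⊕ X) ≥ oL (H ⊕ X) and oR (G ⊕ X) ≥ oR (H ⊕ X) simultaneously. Suppose
-- Left wins H ⊕ X moving first. If H ⊕ X is Left end-like then, X being a
-- game, H is Left end-like and X is a Left end, so (iv) applies. A winning
-- move to H ⊕ Xᴸ is copied in G ⊕ Xᴸ by the Right-first inequality for the
-- smaller Xᴸ. A winning move to Hᴸ ⊕ X is answered by (ii): either Left has
-- a move Gᴸ ⊕ X at least as good, or G ⊕ X is at least as good as
-- Hᴸᴿ ⊕ X, a Right option of a position won by Left going second. The
-- Right-first inequality is the mirror image, using (i) and (iii).
module Submission where

open import Defs
open import Data.Fin using (Fin; zero; suc; splitAt; _↑ˡ_; _↑ʳ_)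
open import Data.Fin.Properties using (splitAt-↑ˡ; splitAt-↑ʳ)
open import Data.Nat using (zero; suc)
open import Data.Bool using (Bool; true; false; _∨_)
open import Data.Sum using (_⊎_; inj₁; inj₂; [_,_]′)
open import Data.Product using (_×_; ∃-syntax; _,_; proj₁; proj₂)
open import Relation.Binary.PropositionalEquality

anyFin-intro : ∀ n (f : Fin n → Bool) i → f i ≡ true → anyFin n f ≡ true
anyFin-intro (suc n) f zero fi≡true rewrite fi≡true = refl
anyFin-intro (suc n) f (suc i) fi≡true with f zero
... | true  = refl
... | false = anyFin-intro n (λ i → f (suc i)) i fi≡true

anyFin-elim : ∀ n (f : Fin n → Bool) → anyFin n f ≡ true → ∃[ i ] f i ≡ true
anyFin-elim (suc n) f any≡true with f zero in f0≡true
... | true  = zero , f0≡true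
... | false with anyFin-elim n (λ i → f (suc i)) any≡true
...   | i , fi≡true = suc i , fi≡true

isLeft⇒≡Left : ∀ {p} → isLeft p ≡ true → p ≡ Left
isLeft⇒≡Left {Left} _ = refl

isRight⇒≡Right : ∀ {p} → isRight p ≡ true → p ≡ Right
isRight⇒≡Right {Right} _ = refl

≥P-fromLeft : ∀ {p q} → (q ≡ Left → p ≡ Left) → p ≥P q
≥P-fromLeft {Left}          _ = L≥
≥P-fromLeft {Right} {Right} _ = R≥R
≥P-fromLeft {Right} {Left}  f with () ← f refl

≥P-fromRight : ∀ {p q} → (p ≡ Right → q ≡ Right) → p ≥P q
≥P-fromRight {Left}          _ = L≥
≥P-fromRight {Right} {Right} _ = R≥R
≥P-fromRight {Right} {Left}  f with () ← f refl

≥P-Left : ∀ {p q} → p ≥P q → q ≡ Left → p ≡ Left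
≥P-Left L≥ _ = refl

≥P-Right : ∀ {p q} → p ≥P q → p ≡ Right → q ≡ Right
≥P-Right R≥R _ = refl

oL-move : ∀ G i → oR (lOpt G i) ≡ Left → oL G ≡ Left
oL-move (mk a b gl gr tL tR) i win with isZero a ∨ tL
... | true  = refl
... | false rewrite anyFin-intro a (λ i → isLeft (oR (gl i))) i (cong isLeft win) = refl

oR-move : ∀ G j → oL (rOpt G j) ≡ Right → oR G ≡ Right
oR-move (mk a b gl gr tL tR) j win with isZero b ∨ tR
... | true  = refl
... | false rewrite anyFin-intro b (λ j → isRight (oL (gr j))) j (cong isRight win) = refl

oL-elim : ∀ G → oL G ≡ Left → leftEndLikeB G ≡ true ⊎ ∃[ i ] oR (lOpt G i) ≡ Left
oL-elim (mk a b gl gr tL tR) win with isZero a ∨ tL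
... | true  = inj₁ refl
... | false with anyFin a (λ i → isLeft (oR (gl i))) in any≡true
...   | true  = let i , good = anyFin-elim a _ any≡true in inj₂ (i , isLeft⇒≡Left good)

oR-elim : ∀ G → oR G ≡ Right → rightEndLikeB G ≡ true ⊎ ∃[ j ] oL (rOpt G j) ≡ Right
oR-elim (mk a b gl gr tL tR) win with isZero b ∨ tR
... | true  = inj₁ refl
... | false with anyFin b (λ j → isRight (oL (gr j))) in any≡true
...   | true  = let j , good = anyFin-elim b _ any≡true in inj₂ (j , isRight⇒≡Right good)

oR≡Left⇒oL-rOpt≡Left : ∀ G → oR G ≡ Left → ∀ j → oL (rOpt G j) ≡ Left
oR≡Left⇒oL-rOpt≡Left G lose j with oL (rOpt G j) in reply
... | Left  = refl
... | Right with () ← trans (sym lose) (oR-move G j reply)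

oL≡Right⇒oR-lOpt≡Right : ∀ G → oL G ≡ Right → ∀ i → oR (lOpt G i) ≡ Right
oL≡Right⇒oR-lOpt≡Right G lose i with oR (lOpt G i) in reply
... | Right = refl
... | Left  with () ← trans (sym lose) (oL-move G i reply)

lOpt-⊕ˡ : ∀ G X k → ∃[ i ] lOpt (G ⊕ X) i ≡ lOpt G k ⊕ X
lOpt-⊕ˡ (mk a _ _ _ _ _) (mk c _ _ _ _ _) k = k ↑ˡ c , cong [ _ , _ ]′ (splitAt-↑ˡ a k c)

lOpt-⊕ʳ : ∀ G X k → ∃[ i ] lOpt (G ⊕ X) i ≡ G ⊕ lOpt X k
lOpt-⊕ʳ (mk a _ _ _ _ _) (mk c _ _ _ _ _) k = a ↑ʳ k , cong [ _ , _ ]′ (splitAt-↑ʳ a c k)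

rOpt-⊕ˡ : ∀ G X k → ∃[ j ] rOpt (G ⊕ X) j ≡ rOpt G k ⊕ X
rOpt-⊕ˡ (mk _ b _ _ _ _) (mk _ d _ _ _ _) k = k ↑ˡ d , cong [ _ , _ ]′ (splitAt-↑ˡ b k d)

rOpt-⊕ʳ : ∀ G X k → ∃[ j ] rOpt (G ⊕ X) j ≡ G ⊕ rOpt X k
rOpt-⊕ʳ (mk _ b _ _ _ _) (mk _ d _ _ _ _) k = b ↑ʳ k , cong [ _ , _ ]′ (splitAt-↑ʳ b d k)

lOpt-⊕ : ∀ G X i → (∃[ k ] lOpt (G ⊕ X) i ≡ lOpt G k ⊕ X) ⊎ (∃[ k ] lOpt (G ⊕ X) i ≡ G ⊕ lOpt X k)
lOpt-⊕ (mk a _ _ _ _ _) (mk _ _ _ _ _ _) i with splitAt a i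
... | inj₁ k = inj₁ (k , refl)
... | inj₂ k = inj₂ (k , refl)

rOpt-⊕ : ∀ G X j → (∃[ k ] rOpt (G ⊕ X) j ≡ rOpt G k ⊕ X) ⊎ (∃[ k ] rOpt (G ⊕ X) j ≡ G ⊕ rOpt X k)
rOpt-⊕ (mk _ b _ _ _ _) (mk _ _ _ _ _ _) j with splitAt b j
... | inj₁ k = inj₁ (k , refl)
... | inj₂ k = inj₂ (k , refl)

⊕-leftEndLike : ∀ G X → tombL X ≡ false → leftEndLikeB (G ⊕ X) ≡ true → LeftEndLike G × LeftEnd X
⊕-leftEndLike (mk zero    _ _ _ _     _) (mk zero    _ _ _ _ _) refl _  = inj₁ refl , refl
⊕-leftEndLike (mk (suc _) _ _ _ true  _) (mk zero    _ _ _ _ _) refl _  = inj₂ refl , refl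
⊕-leftEndLike (mk (suc _) _ _ _ false _) (mk zero    _ _ _ _ _) refl ()
⊕-leftEndLike (mk zero    _ _ _ _     _) (mk (suc _) _ _ _ _ _) refl ()
⊕-leftEndLike (mk (suc _) _ _ _ true  _) (mk (suc _) _ _ _ _ _) refl ()
⊕-leftEndLike (mk (suc _) _ _ _ false _) (mk (suc _) _ _ _ _ _) refl ()

⊕-rightEndLike : ∀ G X → tombR X ≡ false → rightEndLikeB (G ⊕ X) ≡ true → RightEndLike G × RightEnd X
⊕-rightEndLike (mk _ zero    _ _ _ _    ) (mk _ zero    _ _ _ _) refl _  = inj₁ refl , refl
⊕-rightEndLike (mk _ (suc _) _ _ _ true ) (mk _ zero    _ _ _ _) refl _  = inj₂ refl , refl
⊕-rightEndLike (mk _ (suc _) _ _ _ false) (mk _ zero    _ _ _ _) refl ()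
⊕-rightEndLike (mk _ zero    _ _ _ _    ) (mk _ (suc _) _ _ _ _) refl ()
⊕-rightEndLike (mk _ (suc _) _ _ _ true ) (mk _ (suc _) _ _ _ _) refl ()
⊕-rightEndLike (mk _ (suc _) _ _ _ false) (mk _ (suc _) _ _ _ _) refl ()

oL-⊕-moveˡ : ∀ G X k → oR (lOpt G k ⊕ X) ≡ Left → oL (G ⊕ X) ≡ Left
oL-⊕-moveˡ G X k win = let i , eq = lOpt-⊕ˡ G X k in oL-move (G ⊕ X) i (trans (cong oR eq) win)

oL-⊕-moveʳ : ∀ G X k → oR (G ⊕ lOpt X k) ≡ Left → oL (G ⊕ X) ≡ Left
oL-⊕-moveʳ G X k win = let i , eq = lOpt-⊕ʳ G X k in oL-move (G ⊕ X) i (trans (cong oR eq) win)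

oR-⊕-moveˡ : ∀ G X k → oL (rOpt G k ⊕ X) ≡ Right → oR (G ⊕ X) ≡ Right
oR-⊕-moveˡ G X k win = let j , eq = rOpt-⊕ˡ G X k in oR-move (G ⊕ X) j (trans (cong oL eq) win)

oR-⊕-moveʳ : ∀ G X k → oL (G ⊕ rOpt X k) ≡ Right → oR (G ⊕ X) ≡ Right
oR-⊕-moveʳ G X k win = let j , eq = rOpt-⊕ʳ G X k in oR-move (G ⊕ X) j (trans (cong oL eq) win)

oR-⊕≡Left⇒oL-rOptˡ≡Left : ∀ G X → oR (G ⊕ X) ≡ Left → ∀ k → oL (rOpt G k ⊕ X) ≡ Left
oR-⊕≡Left⇒oL-rOptˡ≡Left G X lose k =
  let j , eq = rOpt-⊕ˡ G X k in trans (cong oL (sym eq)) (oR≡Left⇒oL-rOpt≡Left (G ⊕ X) lose j)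

oL-⊕≡Right⇒oR-lOptˡ≡Right : ∀ G X → oL (G ⊕ X) ≡ Right → ∀ k → oR (lOpt G k ⊕ X) ≡ Right
oL-⊕≡Right⇒oR-lOptˡ≡Right G X lose k =
  let i , eq = lOpt-⊕ˡ G X k in trans (cong oR (sym eq)) (oL≡Right⇒oR-lOpt≡Right (G ⊕ X) lose i)

data LeftWinsFirst (G X : Aug) : Set where
  ends   : LeftEndLike G → LeftEnd X → LeftWinsFirst G X
  moveˡ  : ∀ k → oR (lOpt G k ⊕ X) ≡ Left → LeftWinsFirst G X
  moveʳ  : ∀ k → oR (G ⊕ lOpt X k) ≡ Left → LeftWinsFirst G X

data RightWinsFirst (G X : Aug) : Set where
  ends   : RightEndLike G → RightEnd X → RightWinsFirst G X
  moveˡ  : ∀ k → oL (rOpt G k ⊕ X) ≡ Right → RightWinsFirst G X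
  moveʳ  : ∀ k → oL (G ⊕ rOpt X k) ≡ Right → RightWinsFirst G X

oL-⊕-elim : ∀ G X → tombL X ≡ false → oL (G ⊕ X) ≡ Left → LeftWinsFirst G X
oL-⊕-elim G X untombed win with oL-elim (G ⊕ X) win
... | inj₁ endLike = let G-end , X-end = ⊕-leftEndLike G X untombed endLike in ends G-end X-end
... | inj₂ (i , good) with lOpt-⊕ G X i
...   | inj₁ (k , eq) = moveˡ k (trans (cong oR (sym eq)) good)
...   | inj₂ (k , eq) = moveʳ k (trans (cong oR (sym eq)) good)

oR-⊕-elim : ∀ G X → tombR X ≡ false → oR (G ⊕ X) ≡ Right → RightWinsFirst G X
oR-⊕-elim G X untombed win with oR-elim (G ⊕ X) win
... | inj₁ endLike = let G-end , X-end = ⊕-rightEndLike G X untombed endLike in ends G-end X-end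
... | inj₂ (j , good) with rOpt-⊕ G X j
...   | inj₁ (k , eq) = moveˡ k (trans (cong oL (sym eq)) good)
...   | inj₂ (k , eq) = moveʳ k (trans (cong oL (sym eq)) good)

IsGame⇒tombs≡false : ∀ {X} → IsGame X → tombL X ≡ false × tombR X ≡ false
IsGame⇒tombs≡false (isGame _ _) = refl , refl

module Comparison (𝒜 : Aug → Set) (games : ∀ X → 𝒜 X → IsGame X) (hereditary : Hereditary 𝒜)
    (G H : Aug)
    (rightOpts : ∀ (i : Fin (nR G)) →
        (∃[ j ] (rOpt G i ≥[ 𝒜 ] rOpt H j)) ⊎ (∃[ k ] (lOpt (rOpt G i) k ≥[ 𝒜 ] H)))
    (leftOpts : ∀ (i : Fin (nL H)) →
        (∃[ j ] (lOpt G j ≥[ 𝒜 ] lOpt H i)) ⊎ (∃[ k ] (G ≥[ 𝒜 ] rOpt (lOpt H i) k)))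
    (rightStrong : RightEndLike G → RightStrong 𝒜 H)
    (leftStrong : LeftEndLike H → LeftStrong 𝒜 G) where

  oL-≥ : ∀ X → 𝒜 X → oL (G ⊕ X) ≥P oL (H ⊕ X)
  oR-≥ : ∀ X → 𝒜 X → oR (G ⊕ X) ≥P oR (H ⊕ X)

  oL-≥ X@(mk _ _ xl _ _ _) X∈𝒜 = ≥P-fromLeft leftWinsG
    where
    leftWinsG : oL (H ⊕ X) ≡ Left → oL (G ⊕ X) ≡ Left
    leftWinsG onH with oL-⊕-elim H X (proj₁ (IsGame⇒tombs≡false (games X X∈𝒜))) onH
    ... | ends H-end X-end = leftStrong H-end X X∈𝒜 X-end
    ... | moveʳ k win = oL-⊕-moveʳ G X k (≥P-Left (oR-≥ (xl k) (proj₁ (hereditary X X∈𝒜) k)) win)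
    ... | moveˡ k win with leftOpts k
    ...   | inj₁ (j , Gʲ≥Hᵏ) = oL-⊕-moveˡ G X j (≥P-Left (proj₂ (Gʲ≥Hᵏ X X∈𝒜)) win)
    ...   | inj₂ (j , G≥Hᵏʲ) =
            ≥P-Left (proj₁ (G≥Hᵏʲ X X∈𝒜)) (oR-⊕≡Left⇒oL-rOptˡ≡Left (lOpt H k) X win j)

  oR-≥ X@(mk _ _ _ xr _ _) X∈𝒜 = ≥P-fromRight rightWinsH
    where
    rightWinsH : oR (G ⊕ X) ≡ Right → oR (H ⊕ X) ≡ Right
    rightWinsH onG with oR-⊕-elim G X (proj₂ (IsGame⇒tombs≡false (games X X∈𝒜))) onG
    ... | ends G-end X-end = rightStrong G-end X X∈𝒜 X-end
    ... | moveʳ k win = oR-⊕-moveʳ H X k (≥P-Right (oL-≥ (xr k) (proj₂ (hereditary X X∈𝒜) k)) win)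
    ... | moveˡ k win with rightOpts k
    ...   | inj₁ (j , Gᵏ≥Hʲ) = oR-⊕-moveˡ H X j (≥P-Right (proj₁ (Gᵏ≥Hʲ X X∈𝒜)) win)
    ...   | inj₂ (j , Gᵏʲ≥H) =
            ≥P-Right (proj₂ (Gᵏʲ≥H X X∈𝒜)) (oL-⊕≡Right⇒oR-lOptˡ≡Right (rOpt G k) X win j)

proposition2p4 : (𝒜 : Aug → Set) → (∀ X → 𝒜 X → IsGame X) → Hereditary 𝒜 →
    (G H : Aug) →
    (∀ (i : Fin (nR G)) →
        (∃[ j ] (rOpt G i ≥[ 𝒜 ] rOpt H j))
        ⊎ (∃[ k ] (lOpt (rOpt G i) k ≥[ 𝒜 ] H))) →
    (∀ (i : Fin (nL H)) →
        (∃[ j ] (lOpt G j ≥[ 𝒜 ] lOpt H i))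
        ⊎ (∃[ k ] (G ≥[ 𝒜 ] rOpt (lOpt H i) k))) →
    (RightEndLike G → RightStrong 𝒜 H) →
    (LeftEndLike H → LeftStrong 𝒜 G) →
    G ≥[ 𝒜 ] H
proposition2p4 𝒜 games hereditary G H rightOpts leftOpts rightStrong leftStrong X X∈𝒜 =
  oL-≥ X X∈𝒜 , oR-≥ X X∈𝒜
  where open Comparison 𝒜 games hereditary G H rightOpts leftOpts rightStrong leftStrong
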